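{- For any connected graph $G$ with at least three vertices, there exist a minimum power dominating set $S$ of $G$ and a collection of minimal forts $F_1,F_2,\dots,F_k$ of $G$ such that $S\subseteq\bigcup_{i=1}^k\mathfrak{e}(F_i)$.
   Context: Graphs are finite and simple. Power domination: from $S\subseteq V(G)$, first observe $N[S]$; then repeatedly, while some observed vertex has exactly one unobserved neighbor, that neighbor becomes observed. $S$ is a power dominating set if all of $V(G)$ becomes observed; a minimum power dominating set is one of minimum size. A fort is a nonempty set $F\subseteq V(G)$ such that no vertex of $V(G)\setminus F$ has exactly one neighbor in $F$; a minimal fort is a fort containing no other fort as a proper subset. The entrance $\mathfrak{e}(F)$ of a fort $F$ is the set of vertices in $V(G)\setminus F$ having a neighbor in $F$. -}

module Defs where

open import Data.Nat using (ℕ; _≤_)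
open import Data.Bool using (Bool; true; false; _∧_)
open import Data.Fin using (Fin)
open import Data.Fin.Subset using (Subset; _∈_; _∉_; _⊆_; ∣_∣; inside)
open import Data.Vec using (tabulate; lookup)
open import Data.Product using (Σ; ∃; _×_)
open import Relation.Binary.PropositionalEquality using (_≡_; _≢_)
open import Relation.Nullary using (¬_)

record Graph (n : ℕ) : Set where
  field
    adj    : Fin n → Fin n → Bool
    sym    : ∀ u v → adj u v ≡ adj v u
    irrefl : ∀ v → adj v v ≡ false
open Graph public

Adj : ∀ {n} → Graph n → Fin n → Fin n → Set
Adj G u v = adj G u v ≡ true

data Reach {n} (G : Graph n) (u : Fin n) : Fin n → Set where
  here : Reach G u u
  step : ∀ {w v} → Reach G u w → Adj G w v → Reach G u v

Connected : ∀ {n} → Graph n → Set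
Connected {n} G = ∀ (u v : Fin n) → Reach G u v

data Observed {n} (G : Graph n) (S : Subset n) : Fin n → Set where
  self  : ∀ {v} → v ∈ S → Observed G S v
  nbr   : ∀ {u v} → u ∈ S → Adj G u v → Observed G S v
  force : ∀ {u v} → Observed G S u → Adj G u v →
          (∀ w → Adj G u w → w ≢ v → Observed G S w) → Observed G S v

PowerDominating : ∀ {n} → Graph n → Subset n → Set
PowerDominating {n} G S = ∀ (v : Fin n) → Observed G S v

MinimumPowerDominating : ∀ {n} → Graph n → Subset n → Set
MinimumPowerDominating {n} G S =
  PowerDominating G S × (∀ (T : Subset n) → PowerDominating G T → ∣ S ∣ ≤ ∣ T ∣)

nbrsIn : ∀ {n} → Graph n → Fin n → Subset n → Subset n
nbrsIn G u F = tabulate (λ w → adj G u w ∧ lookup F w)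

Fort : ∀ {n} → Graph n → Subset n → Set
Fort {n} G F =
  (∃ λ (v : Fin n) → v ∈ F) × (∀ (u : Fin n) → u ∉ F → ∣ nbrsIn G u F ∣ ≢ 1)

MinimalFort : ∀ {n} → Graph n → Subset n → Set
MinimalFort {n} G F =
  Fort G F × (∀ (F' : Subset n) → Fort G F' → F' ⊆ F → F' ≡ F)

InEntrance : ∀ {n} → Graph n → Subset n → Fin n → Set
InEntrance {n} G F v = v ∉ F × (∃ λ (w : Fin n) → w ∈ F × Adj G v w)

-- Among the minimum power dominating sets choose S with the fewest vertices
-- that are not entrance vertices of a minimal fort, and suppose v ∈ S is such
-- a vertex.  A set is power dominating iff its closed neighbourhood meets
-- every minimal fort, so R = S - v, being too small, misses some minimal forts
-- ("blocking" forts), and v lies in all of them: S meets each of them, only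
-- through v, and v is not an entrance vertex.  In a connected graph on at
-- least three vertices some vertex has degree ≠ 1, so V - z is a fort and no
-- minimal fort is all of V.  Hence some vertex escapes a blocking fort, and a
-- path from v to it crosses an edge ab with a in every blocking fort and b
-- outside one of them.  Then b is an entrance vertex, R ∪ {b} still meets every
-- minimal fort (through a), and it has fewer non-entrance vertices than S.
module Submission where

open import Defs
open import Data.Nat using (ℕ; zero; suc; _≤_; _<_; _+_; s≤s)
open import Data.Nat.Properties
  using (≤-refl; ≤-trans; <⇒≤; <⇒≱; ≤⇒≯; ≮⇒≥; +-comm; +-suc; +-monoʳ-≤; n≤1+n; _<?_; _≤?_; module ≤-Reasoning)
  renaming (_≟_ to _≟ℕ_)
open import Data.Nat.Induction using (<-wellFounded)
open import Data.Bool using (Bool; true; false; _∧_)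
open import Data.Bool.Properties using (∧-conicalˡ; ∧-conicalʳ) renaming (_≟_ to _≟ᵇ_)
open import Data.Fin using (Fin; zero; suc) renaming (_≟_ to _≟ᶠ_)
open import Data.Fin.Properties using (any?; all?)
open import Data.Fin.Subset using (Subset; _∈_; _∉_; _⊆_; ∣_∣; ⊤; ⁅_⁆; _-_; _─_; _∪_; _∩_)
open import Data.Fin.Subset.Properties
  using (_∈?_; _⊆?_; nonempty?; anySubset?; Empty-unique; ∣⊥∣≡0; ∣⁅x⁆∣≡1; x∈⁅x⁆; x∈⁅y⁆⇒x≡y;
         ∈⊤; ∣p∣≤n; p⊆q⇒∣p∣≤∣q∣; p⊂q⇒∣p∣<∣q∣; ⊆-antisym; x∈p⇒∣p-x∣<∣p∣; x∈p∧x≢y⇒x∈p-y;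
         p─q⊆p; p⊆p∪q; x∈p∪q⁺; x∈p∪q⁻; x∈p∩q⁺; x∈p∩q⁻)
open import Data.Vec using ([]; _∷_; here; there; tabulate)
open import Data.Vec.Properties using (lookup∘tabulate; lookup⇒[]=; []=⇒lookup; ≡-dec)
open import Data.Product using (Σ; ∃; ∃₂; _×_; _,_; proj₁; proj₂)
open import Data.Sum using (_⊎_; inj₁; inj₂)
open import Data.Empty using (⊥-elim)
open import Function using (_on_)
open import Induction.WellFounded using (Acc; acc)
open import Relation.Binary.Construct.On using (wellFounded)
open import Relation.Binary.Definitions using (DecidableEquality)
open import Relation.Nullary using (¬_; Dec; yes; no; does)
open import Relation.Nullary.Decidable using (¬?; _×-dec_; _⊎-dec_; _→-dec_; dec-true; decidable-stable)
open import Relation.Nullary.Negation using (contradiction)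
open import Relation.Binary.PropositionalEquality
  using (_≡_; _≢_; refl; trans; cong; cong₂; subst) renaming (sym to ≡-sym)

∈-tabulate⁺ : ∀ {n} {f : Fin n → Bool} {i} → f i ≡ true → i ∈ tabulate f
∈-tabulate⁺ {f = f} {i} fi = lookup⇒[]= i (tabulate f) (trans (lookup∘tabulate f i) fi)

∈-tabulate⁻ : ∀ {n} {f : Fin n → Bool} {i} → i ∈ tabulate f → f i ≡ true
∈-tabulate⁻ {f = f} {i} i∈ = trans (≡-sym (lookup∘tabulate f i)) ([]=⇒lookup i∈)

select : ∀ {n} {P : Fin n → Set} → (∀ i → Dec (P i)) → Subset n
select P? = tabulate (λ i → does (P? i))

∈-select⁺ : ∀ {n} {P : Fin n → Set} (P? : ∀ i → Dec (P i)) {i} → P i → i ∈ select P?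
∈-select⁺ P? {i} Pi = ∈-tabulate⁺ (dec-true (P? i) Pi)

∈-select⁻ : ∀ {n} {P : Fin n → Set} (P? : ∀ i → Dec (P i)) {i} → i ∈ select P? → P i
∈-select⁻ P? {i} i∈ with P? i | ∈-tabulate⁻ {f = λ j → does (P? j)} i∈
... | yes Pi | _ = Pi

_≟ˢ_ : ∀ {n} → DecidableEquality (Subset n)
_≟ˢ_ = ≡-dec _≟ᵇ_

x∈p─q⇒x∉q : ∀ {n} {p q : Subset n} {x} → x ∈ p ─ q → x ∉ q
x∈p─q⇒x∉q {p = _ ∷ _} {false ∷ _} here ()
x∈p─q⇒x∉q {p = _ ∷ _} {_ ∷ _} (there x∈) (there x∈q) = x∈p─q⇒x∉q x∈ x∈q

x∈p⇒0<∣p∣ : ∀ {n} {p : Subset n} {x} → x ∈ p → 0 < ∣ p ∣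
x∈p⇒0<∣p∣ {p = p} {x} x∈p = subst (_≤ ∣ p ∣) (∣⁅x⁆∣≡1 x) (p⊆q⇒∣p∣≤∣q∣ ⁅x⁆⊆p)
  where
  ⁅x⁆⊆p : ⁅ x ⁆ ⊆ p
  ⁅x⁆⊆p y∈⁅x⁆ = subst (_∈ p) (≡-sym (x∈⁅y⁆⇒x≡y _ y∈⁅x⁆)) x∈p

∃!⇒∣p∣≡1 : ∀ {n} {p : Subset n} {x} → x ∈ p → (∀ {y} → y ∈ p → y ≡ x) → ∣ p ∣ ≡ 1
∃!⇒∣p∣≡1 {p = p} {x} x∈p unique = trans (cong ∣_∣ p≡⁅x⁆) (∣⁅x⁆∣≡1 x)
  where
  p≡⁅x⁆ : p ≡ ⁅ x ⁆
  p≡⁅x⁆ = ⊆-antisym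
    (λ y∈p → subst (_∈ ⁅ x ⁆) (≡-sym (unique y∈p)) (x∈⁅x⁆ x))
    (λ y∈⁅x⁆ → subst (_∈ p) (≡-sym (x∈⁅y⁆⇒x≡y _ y∈⁅x⁆)) x∈p)

∣p∣≡1⇒∃! : ∀ {n} (p : Subset n) → ∣ p ∣ ≡ 1 → ∃ λ x → x ∈ p × (∀ {y} → y ∈ p → y ≡ x)
∣p∣≡1⇒∃! {n} p ∣p∣≡1 with nonempty? p
... | no empty = contradiction (trans (≡-sym (trans (cong ∣_∣ (Empty-unique empty)) (∣⊥∣≡0 n))) ∣p∣≡1) λ ()
... | yes (x , x∈p) = x , x∈p , unique
  where
  unique : ∀ {y} → y ∈ p → y ≡ x
  unique {y} y∈p with y ≟ᶠ x
  ... | yes y≡x = y≡x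
  ... | no y≢x = contradiction
    (≤-trans (s≤s (x∈p⇒0<∣p∣ (x∈p∧x≢y⇒x∈p-y y∈p y≢x))) (x∈p⇒∣p-x∣<∣p∣ x∈p))
    (λ 2≤∣p∣ → ≤⇒≯ (subst (_≤ 1) (≡-sym ∣p∣≡1) ≤-refl) 2≤∣p∣)

∣p∪q∣≤∣p∣+∣q∣ : ∀ {n} (p q : Subset n) → ∣ p ∪ q ∣ ≤ ∣ p ∣ + ∣ q ∣
∣p∪q∣≤∣p∣+∣q∣ []          []          = ≤-refl
∣p∪q∣≤∣p∣+∣q∣ (true ∷ p)  (true ∷ q)  = s≤s (≤-trans (∣p∪q∣≤∣p∣+∣q∣ p q) (+-monoʳ-≤ ∣ p ∣ (n≤1+n ∣ q ∣)))
∣p∪q∣≤∣p∣+∣q∣ (true ∷ p)  (false ∷ q) = s≤s (∣p∪q∣≤∣p∣+∣q∣ p q)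
∣p∪q∣≤∣p∣+∣q∣ (false ∷ p) (true ∷ q)  = subst (suc ∣ p ∪ q ∣ ≤_) (≡-sym (+-suc ∣ p ∣ ∣ q ∣)) (s≤s (∣p∪q∣≤∣p∣+∣q∣ p q))
∣p∪q∣≤∣p∣+∣q∣ (false ∷ p) (false ∷ q) = ∣p∪q∣≤∣p∣+∣q∣ p q

p⊆q∧∣q∣≤∣p∣⇒p≡q : ∀ {n} {p q : Subset n} → p ⊆ q → ∣ q ∣ ≤ ∣ p ∣ → p ≡ q
p⊆q∧∣q∣≤∣p∣⇒p≡q {p = p} {q} p⊆q ∣q∣≤∣p∣ = ⊆-antisym p⊆q q⊆p
  where
  q⊆p : q ⊆ p
  q⊆p {x} x∈q with x ∈? p
  ... | yes x∈p = x∈p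
  ... | no x∉p = contradiction (p⊂q⇒∣p∣<∣q∣ (p⊆q , x , x∈q , x∉p)) (≤⇒≯ ∣q∣≤∣p∣)

allSubsets? : ∀ {n} {P : Subset n → Set} → (∀ p → Dec (P p)) → Dec (∀ p → P p)
allSubsets? P? with anySubset? (λ p → ¬? (P? p))
... | yes (p , ¬Pp) = no (λ ∀P → ¬Pp (∀P p))
... | no ¬∃¬P = yes (λ p → decidable-stable (P? p) (λ ¬Pp → ¬∃¬P (p , ¬Pp)))

argmin : ∀ {n} {P : Subset n → Set} → (∀ p → Dec (P p)) → (μ : Subset n → ℕ) →
         ∀ {p} → P p → ∃ λ q → P q × (∀ r → P r → μ q ≤ μ r)
argmin {n} {P} P? μ {p} Pp = descend p (wellFounded μ <-wellFounded p) Pp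
  where
  descend : ∀ q → Acc (_<_ on μ) q → P q → ∃ λ q → P q × (∀ r → P r → μ q ≤ μ r)
  descend q (acc smaller) Pq with anySubset? (λ r → P? r ×-dec (μ r <? μ q))
  ... | yes (r , Pr , μr<μq) = descend r (smaller μr<μq) Pr
  ... | no none = q , Pq , λ r Pr → ≮⇒≥ (λ μr<μq → none (r , Pr , μr<μq))

other-vertex : ∀ {n} → 2 ≤ n → (z : Fin n) → ∃ λ y → y ≢ z
other-vertex (s≤s (s≤s _)) zero    = suc zero , λ ()
other-vertex (s≤s (s≤s _)) (suc _) = zero , λ ()

module _ {n : ℕ} (G : Graph n) where

  adj? : ∀ u v → Dec (Adj G u v)
  adj? u v = adj G u v ≟ᵇ true

  adj-sym : ∀ {u v} → Adj G u v → Adj G v u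
  adj-sym {u} {v} u~v = trans (sym G v u) u~v

  adj⇒≢ : ∀ {u v} → Adj G u v → u ≢ v
  adj⇒≢ {u} u~u refl = contradiction (trans (≡-sym u~u) (irrefl G u)) λ ()

  ∈nbrsIn⁺ : ∀ {u w F} → Adj G u w → w ∈ F → w ∈ nbrsIn G u F
  ∈nbrsIn⁺ u~w w∈F = ∈-tabulate⁺ (cong₂ _∧_ u~w ([]=⇒lookup w∈F))

  ∈nbrsIn⁻ : ∀ {u w F} → w ∈ nbrsIn G u F → Adj G u w × w ∈ F
  ∈nbrsIn⁻ {u} {w} {F} w∈ = ∧-conicalˡ _ _ both , lookup⇒[]= w F (∧-conicalʳ _ _ both)
    where both = ∈-tabulate⁻ w∈

  Meets : Subset n → Subset n → Set
  Meets T F = ∃ λ x → x ∈ F × (x ∈ T ⊎ ∃ λ u → u ∈ T × Adj G u x)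

  meets? : ∀ T F → Dec (Meets T F)
  meets? T F = any? λ x → (x ∈? F) ×-dec ((x ∈? T) ⊎-dec any? (λ u → (u ∈? T) ×-dec adj? u x))

  meets-mono : ∀ {T T′ F F′} → T ⊆ T′ → F ⊆ F′ → Meets T F → Meets T′ F′
  meets-mono T⊆T′ F⊆F′ (x , x∈F , inj₁ x∈T)             = x , F⊆F′ x∈F , inj₁ (T⊆T′ x∈T)
  meets-mono T⊆T′ F⊆F′ (x , x∈F , inj₂ (u , u∈T , u~x)) = x , F⊆F′ x∈F , inj₂ (u , T⊆T′ u∈T , u~x)

  fort? : ∀ F → Dec (Fort G F)
  fort? F = nonempty? F ×-dec all? (λ u → ¬? (u ∈? F) →-dec ¬? (∣ nbrsIn G u F ∣ ≟ℕ 1))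

  minimalFort? : ∀ F → Dec (MinimalFort G F)
  minimalFort? F = fort? F ×-dec allSubsets? (λ F′ → fort? F′ →-dec ((F′ ⊆? F) →-dec (F′ ≟ˢ F)))

  inEntrance? : ∀ F v → Dec (InEntrance G F v)
  inEntrance? F v = ¬? (v ∈? F) ×-dec any? (λ w → (w ∈? F) ×-dec adj? v w)

  ⊤-fort : Fin n → Fort G ⊤
  ⊤-fort v = (v , ∈⊤) , λ u u∉⊤ → contradiction ∈⊤ u∉⊤

  ⊤-minus-fort : ∀ {z} → (∃ λ y → y ≢ z) → ∣ nbrsIn G z (⊤ - z) ∣ ≢ 1 → Fort G (⊤ - z)
  ⊤-minus-fort {z} (y , y≢z) deg≢1 = (y , x∈p∧x≢y⇒x∈p-y ∈⊤ y≢z) , outside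
    where
    outside : ∀ u → u ∉ ⊤ - z → ∣ nbrsIn G u (⊤ - z) ∣ ≢ 1
    outside u u∉ with u ≟ᶠ z
    ... | yes refl = deg≢1
    ... | no u≢z = contradiction (x∈p∧x≢y⇒x∈p-y ∈⊤ u≢z) u∉

  fort⇒minimalFort⊆ : ∀ {X} → Fort G X → ∃ λ F → MinimalFort G F × F ⊆ X
  fort⇒minimalFort⊆ {X} fortX with argmin (λ Y → fort? Y ×-dec (Y ⊆? X)) ∣_∣ (fortX , λ x∈ → x∈)
  ... | F , (fortF , F⊆X) , smallest = F , (fortF , minimal) , F⊆X
    where
    minimal : ∀ F′ → Fort G F′ → F′ ⊆ F → F′ ≡ F
    minimal F′ fortF′ F′⊆F = p⊆q∧∣q∣≤∣p∣⇒p≡q F′⊆F (smallest F′ (fortF′ , λ x∈ → F⊆X (F′⊆F x∈)))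

  degree1⇒unique-neighbour : ∀ {a w₁ w₂} → ∣ nbrsIn G a (⊤ - a) ∣ ≡ 1 →
                             Adj G a w₁ → Adj G a w₂ → w₁ ≡ w₂
  degree1⇒unique-neighbour {a} deg1 a~w₁ a~w₂ with ∣p∣≡1⇒∃! _ deg1
  ... | _ , _ , unique = trans (unique (neighbour a~w₁)) (≡-sym (unique (neighbour a~w₂)))
    where
    neighbour : ∀ {w} → Adj G a w → w ∈ nbrsIn G a (⊤ - a)
    neighbour a~w = ∈nbrsIn⁺ a~w (x∈p∧x≢y⇒x∈p-y ∈⊤ (λ w≡a → adj⇒≢ a~w (≡-sym w≡a)))

  reach⇒≡⊎adj : (∀ {a w₁ w₂} → Adj G a w₁ → Adj G a w₂ → w₁ ≡ w₂) →
                ∀ {a w} → Reach G a w → w ≡ a ⊎ Adj G a w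
  reach⇒≡⊎adj unique here = inj₁ refl
  reach⇒≡⊎adj unique (step a⇝w w~u) with reach⇒≡⊎adj unique a⇝w
  ... | inj₁ refl = inj₂ w~u
  ... | inj₂ a~w  = inj₁ (unique w~u (adj-sym a~w))

  boundary-edge : ∀ {P : Fin n → Set} → (∀ v → Dec (P v)) → ∀ {a w} →
                  Reach G a w → ¬ P a → P w → ∃₂ λ x y → ¬ P x × P y × Adj G x y
  boundary-edge P? here ¬Pa Pw = contradiction Pw ¬Pa
  boundary-edge P? (step {u} a⇝u u~w) ¬Pa Pw with P? u
  ... | yes Pu = boundary-edge P? a⇝u ¬Pa Pu
  ... | no ¬Pu = u , _ , ¬Pu , Pw , u~w

  ObservedOutside : Subset n → Subset n → Set
  ObservedOutside T X = ∀ w → w ∉ X → Observed G T w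

  observedOutside-remove : ∀ {T X x} → Observed G T x → ObservedOutside T X → ObservedOutside T (X - x)
  observedOutside-remove {x = x} obs-x obs w w∉ with w ≟ᶠ x
  ... | yes refl = obs-x
  ... | no w≢x = obs w (λ w∈X → w∉ (x∈p∧x≢y⇒x∈p-y w∈X w≢x))

  forced-vertex : ∀ {T X u} → ObservedOutside T X → u ∉ X → ∣ nbrsIn G u X ∣ ≡ 1 →
                  ∃ λ x → x ∈ X × Observed G T x
  forced-vertex {T} {X} {u} obs u∉X deg1 with ∣p∣≡1⇒∃! _ deg1
  ... | x , x∈ , unique = x , proj₂ (∈nbrsIn⁻ {F = X} x∈) , force (obs u u∉X) (proj₁ (∈nbrsIn⁻ {F = X} x∈)) others
    where
    others : ∀ w → Adj G u w → w ≢ x → Observed G T w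
    others w u~w w≢x = obs w (λ w∈X → w≢x (unique (∈nbrsIn⁺ u~w w∈X)))

  observable-or-avoidedFort : ∀ {T X} → ObservedOutside T X → ∃ (_∈ X) →
                              (∃ λ x → x ∈ X × Observed G T x) ⊎ (Fort G X × ¬ Meets T X)
  observable-or-avoidedFort {T} {X} obs nonempty with meets? T X
  ... | yes (x , x∈X , inj₁ x∈T)             = inj₁ (x , x∈X , self x∈T)
  ... | yes (x , x∈X , inj₂ (u , u∈T , u~x)) = inj₁ (x , x∈X , nbr u∈T u~x)
  ... | no ¬meets with any? (λ u → ¬? (u ∈? X) ×-dec (∣ nbrsIn G u X ∣ ≟ℕ 1))
  ...   | yes (u , u∉X , deg1) = inj₁ (forced-vertex obs u∉X deg1)
  ...   | no none = inj₂ ((nonempty , λ u u∉X deg1 → none (u , u∉X , deg1)) , ¬meets)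

  -- Shrink the set of possibly unobserved vertices until it is empty or a fort.
  pd-or-avoidedFort : ∀ T → PowerDominating G T ⊎ ∃ λ F → Fort G F × ¬ Meets T F
  pd-or-avoidedFort T = shrink (suc n) ⊤ (s≤s (∣p∣≤n ⊤)) (λ w w∉⊤ → contradiction ∈⊤ w∉⊤)
    where
    shrink : ∀ k X → ∣ X ∣ < k → ObservedOutside T X → PowerDominating G T ⊎ ∃ λ F → Fort G F × ¬ Meets T F
    shrink (suc k) X (s≤s ∣X∣≤k) obs with nonempty? X
    ... | no empty = inj₁ (λ w → obs w (λ w∈X → empty (w , w∈X)))
    ... | yes nonempty with observable-or-avoidedFort obs nonempty
    ...   | inj₂ (fortX , ¬meets) = inj₂ (X , fortX , ¬meets)
    ...   | inj₁ (x , x∈X , obs-x) =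
      shrink k (X - x) (≤-trans (x∈p⇒∣p-x∣<∣p∣ x∈X) ∣X∣≤k) (observedOutside-remove obs-x obs)

  -- An observed vertex u ∉ F can only force into F if it has exactly one neighbour in F.
  observed∉avoidedFort : ∀ {T F v} → Fort G F → ¬ Meets T F → Observed G T v → v ∉ F
  observed∉avoidedFort _ ¬meets (self v∈T) v∈F = ¬meets (_ , v∈F , inj₁ v∈T)
  observed∉avoidedFort _ ¬meets (nbr u∈T u~v) v∈F = ¬meets (_ , v∈F , inj₂ (_ , u∈T , u~v))
  observed∉avoidedFort {T} {F} fortF ¬meets (force {u} {v} obs-u u~v others) v∈F =
    proj₂ fortF u (observed∉avoidedFort fortF ¬meets obs-u) (∃!⇒∣p∣≡1 (∈nbrsIn⁺ u~v v∈F) only-v)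
    where
    only-v : ∀ {w} → w ∈ nbrsIn G u F → w ≡ v
    only-v {w} w∈ with w ≟ᶠ v
    ... | yes w≡v = w≡v
    ... | no w≢v = contradiction (proj₂ (∈nbrsIn⁻ {F = F} w∈))
                     (observed∉avoidedFort fortF ¬meets (others w (proj₁ (∈nbrsIn⁻ {F = F} w∈)) w≢v))

  pd⇒meets : ∀ {T F} → PowerDominating G T → Fort G F → Meets T F
  pd⇒meets {T} {F} pd fortF@((x , x∈F) , _) =
    decidable-stable (meets? T F) (λ ¬meets → observed∉avoidedFort fortF ¬meets (pd x) x∈F)

  pd? : ∀ T → Dec (PowerDominating G T)
  pd? T with pd-or-avoidedFort T
  ... | inj₁ pd = yes pd
  ... | inj₂ (F , fortF , ¬meets) = no (λ pd → ¬meets (pd⇒meets pd fortF))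

  pd-or-avoidedMinimalFort : ∀ T → PowerDominating G T ⊎ ∃ λ F → MinimalFort G F × ¬ Meets T F
  pd-or-avoidedMinimalFort T with pd-or-avoidedFort T
  ... | inj₁ pd = inj₁ pd
  ... | inj₂ (X , fortX , ¬meets) with fort⇒minimalFort⊆ fortX
  ...   | F , minF , F⊆X = inj₂ (F , minF , λ meets → ¬meets (meets-mono (λ x∈ → x∈) F⊆X meets))

  EntranceVertex : Fin n → Set
  EntranceVertex v = ∃ λ F → MinimalFort G F × InEntrance G F v

  entranceVertex? : ∀ v → Dec (EntranceVertex v)
  entranceVertex? v = anySubset? (λ F → minimalFort? F ×-dec inEntrance? F v)

  nonEntrance : Subset n
  nonEntrance = select (λ v → ¬? (entranceVertex? v))

  nonEntranceCount : Subset n → ℕ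
  nonEntranceCount T = ∣ T ∩ nonEntrance ∣

¬all-degree1 : ∀ {n} (G : Graph n) → 3 ≤ n → Connected G → ¬ (∀ z → ∣ nbrsIn G z (⊤ - z) ∣ ≡ 1)
¬all-degree1 G (s≤s (s≤s (s≤s _))) conn deg1 =
  contradiction (unique (adjacent-to-0 {suc zero} λ ()) (adjacent-to-0 {suc (suc zero)} λ ())) λ ()
  where
  unique : ∀ {a w₁ w₂} → Adj G a w₁ → Adj G a w₂ → w₁ ≡ w₂
  unique = degree1⇒unique-neighbour G (deg1 _)
  adjacent-to-0 : ∀ {w} → w ≢ zero → Adj G zero w
  adjacent-to-0 {w} w≢0 with reach⇒≡⊎adj G unique (conn zero w)
  ... | inj₁ w≡0 = contradiction w≡0 w≢0
  ... | inj₂ 0~w = 0~w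

minimalFort-misses-vertex : ∀ {n} (G : Graph n) → 3 ≤ n → Connected G →
                            ∀ {F} → MinimalFort G F → ∃ λ y → y ∉ F
minimalFort-misses-vertex G three conn {F} (_ , minimal) with any? (λ y → ¬? (y ∈? F))
... | yes missed = missed
... | no none with any? (λ z → ¬? (∣ nbrsIn G z (⊤ - z) ∣ ≟ℕ 1))
...   | no all-degree1 =
  ⊥-elim (¬all-degree1 G three conn (λ z → decidable-stable (_ ≟ℕ 1) (λ deg≢1 → all-degree1 (z , deg≢1))))
...   | yes (z , deg≢1) = contradiction (subst (z ∈_) (≡-sym ⊤-z≡F) (all∈F z)) (λ z∈ → x∈p─q⇒x∉q z∈ (x∈⁅x⁆ z))
  where
  all∈F : ∀ y → y ∈ F
  all∈F y = decidable-stable (y ∈? F) (λ y∉F → none (y , y∉F))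
  ⊤-z≡F : ⊤ - z ≡ F
  ⊤-z≡F = minimal (⊤ - z) (⊤-minus-fort G (other-vertex (<⇒≤ three) z) deg≢1) (λ {y} _ → all∈F y)

module Exchange {n} {G : Graph n} (three : 3 ≤ n) (conn : Connected G)
                {S : Subset n} (minS : MinimumPowerDominating G S)
                {v : Fin n} (v∈S : v ∈ S) (v-not-entrance : ¬ EntranceVertex G v) where

  R : Subset n
  R = S - v

  Blocking : Subset n → Set
  Blocking F = MinimalFort G F × ¬ Meets G R F

  Escapes : Fin n → Set
  Escapes y = ∃ λ F → Blocking F × y ∉ F

  escapes? : ∀ y → Dec (Escapes y)
  escapes? y = anySubset? λ F → (minimalFort? G F ×-dec ¬? (meets? G R F)) ×-dec ¬? (y ∈? F)

  ¬escapes⇒∈blocking : ∀ {y F} → ¬ Escapes y → Blocking F → y ∈ F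
  ¬escapes⇒∈blocking {y} {F} stuck blocking = decidable-stable (y ∈? F) (λ y∉F → stuck (F , blocking , y∉F))

  -- S meets every blocking fort, and it can only do so through v.
  v-not-escapes : ¬ Escapes v
  v-not-escapes (F , (minF , ¬meetsR) , v∉F) with pd⇒meets G (proj₁ minS) (proj₁ minF)
  ... | x , x∈F , inj₁ x∈S with x ≟ᶠ v
  ...   | yes refl = v∉F x∈F
  ...   | no x≢v = ¬meetsR (x , x∈F , inj₁ (x∈p∧x≢y⇒x∈p-y x∈S x≢v))
  v-not-escapes (F , (minF , ¬meetsR) , v∉F) | x , x∈F , inj₂ (u , u∈S , u~x) with u ≟ᶠ v
  ...   | yes refl = v-not-entrance (F , minF , v∉F , x , x∈F , u~x)
  ...   | no u≢v = ¬meetsR (x , x∈F , inj₂ (u , x∈p∧x≢y⇒x∈p-y u∈S u≢v , u~x))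

  some-vertex-escapes : ∃ Escapes
  some-vertex-escapes with pd-or-avoidedMinimalFort G R
  ... | inj₁ pdR = contradiction (proj₂ minS R pdR) (<⇒≱ (x∈p⇒∣p-x∣<∣p∣ v∈S))
  ... | inj₂ (F , minF , ¬meetsR) with minimalFort-misses-vertex G three conn minF
  ...   | y , y∉F = y , (F , (minF , ¬meetsR) , y∉F)

  module _ {a b : Fin n} (a-stuck : ¬ Escapes a) (a~b : Adj G a b) where

    escaping-neighbour-enters : Escapes b → EntranceVertex G b
    escaping-neighbour-enters (F , (minF , ¬meetsR) , b∉F) =
      F , minF , b∉F , a , ¬escapes⇒∈blocking a-stuck (minF , ¬meetsR) , adj-sym G a~b

    add-neighbour-pd : PowerDominating G (R ∪ ⁅ b ⁆)
    add-neighbour-pd with pd-or-avoidedMinimalFort G (R ∪ ⁅ b ⁆)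
    ... | inj₁ pd = pd
    ... | inj₂ (F , minF , ¬meetsT) = ⊥-elim (¬meetsT (a , a∈F , inj₂ (b , x∈p∪q⁺ (inj₂ (x∈⁅x⁆ b)) , adj-sym G a~b)))
      where
      a∈F : a ∈ F
      a∈F = ¬escapes⇒∈blocking a-stuck (minF , λ meetsR → ¬meetsT (meets-mono G (p⊆p∪q ⁅ b ⁆) (λ x∈ → x∈) meetsR))

  ∣R∪⁅b⁆∣≤∣S∣ : ∀ b → ∣ R ∪ ⁅ b ⁆ ∣ ≤ ∣ S ∣
  ∣R∪⁅b⁆∣≤∣S∣ b = begin
    ∣ R ∪ ⁅ b ⁆ ∣       ≤⟨ ∣p∪q∣≤∣p∣+∣q∣ R ⁅ b ⁆ ⟩
    ∣ R ∣ + ∣ ⁅ b ⁆ ∣   ≡⟨ cong (∣ R ∣ +_) (∣⁅x⁆∣≡1 b) ⟩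
    ∣ R ∣ + 1           ≡⟨ +-comm ∣ R ∣ 1 ⟩
    suc ∣ R ∣           ≤⟨ x∈p⇒∣p-x∣<∣p∣ v∈S ⟩
    ∣ S ∣               ∎
    where open ≤-Reasoning

  fewer-nonEntrance : ∀ {b} → EntranceVertex G b → nonEntranceCount G (R ∪ ⁅ b ⁆) < nonEntranceCount G S
  fewer-nonEntrance {b} b-enters = p⊂q⇒∣p∣<∣q∣ (T∩E⊆S∩E , v , x∈p∩q⁺ (v∈S , ∈-select⁺ notEntrance? v-not-entrance) , v∉T∩E)
    where
    E : Subset n
    E = nonEntrance G
    notEntrance? : ∀ y → Dec (¬ EntranceVertex G y)
    notEntrance? y = ¬? (entranceVertex? G y)
    T∩E⊆R : ∀ {y} → y ∈ (R ∪ ⁅ b ⁆) ∩ E → y ∈ R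
    T∩E⊆R y∈ with x∈p∩q⁻ _ _ y∈
    ... | y∈T , y∈E with x∈p∪q⁻ R ⁅ b ⁆ y∈T
    ...   | inj₁ y∈R = y∈R
    ...   | inj₂ y∈⁅b⁆ = contradiction (subst (EntranceVertex G) (≡-sym (x∈⁅y⁆⇒x≡y _ y∈⁅b⁆)) b-enters)
                                       (∈-select⁻ notEntrance? y∈E)
    T∩E⊆S∩E : (R ∪ ⁅ b ⁆) ∩ E ⊆ S ∩ E
    T∩E⊆S∩E y∈ = x∈p∩q⁺ (p─q⊆p S ⁅ v ⁆ (T∩E⊆R y∈) , proj₂ (x∈p∩q⁻ _ _ y∈))
    v∉T∩E : v ∉ (R ∪ ⁅ b ⁆) ∩ E
    v∉T∩E v∈ = x∈p─q⇒x∉q (T∩E⊆R v∈) (x∈⁅x⁆ v)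

  exchange : ∃ λ T → PowerDominating G T × ∣ T ∣ ≤ ∣ S ∣ × nonEntranceCount G T < nonEntranceCount G S
  exchange with some-vertex-escapes
  ... | y , y-escapes with boundary-edge G escapes? (conn v y) v-not-escapes y-escapes
  ...   | a , b , a-stuck , b-escapes , a~b =
    R ∪ ⁅ b ⁆ , add-neighbour-pd a-stuck a~b , ∣R∪⁅b⁆∣≤∣S∣ b ,
    fewer-nonEntrance (escaping-neighbour-enters a-stuck a~b b-escapes)

minimum-pd-of-entrance-vertices : ∀ {n} (G : Graph n) → 3 ≤ n → Connected G →
  ∃ λ S → MinimumPowerDominating G S × (∀ v → v ∈ S → EntranceVertex G v)
minimum-pd-of-entrance-vertices G three conn
  with argmin (pd? G) ∣_∣ {⊤} (λ _ → self ∈⊤)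
... | S₀ , pdS₀ , leastS₀
  with argmin (λ T → pd? G T ×-dec (∣ T ∣ ≤? ∣ S₀ ∣)) (nonEntranceCount G) (pdS₀ , ≤-refl)
... | S , (pdS , ∣S∣≤∣S₀∣) , fewest = S , minS , all-enter
  where
  minS : MinimumPowerDominating G S
  minS = pdS , λ T pdT → ≤-trans ∣S∣≤∣S₀∣ (leastS₀ T pdT)
  all-enter : ∀ v → v ∈ S → EntranceVertex G v
  all-enter v v∈S = decidable-stable (entranceVertex? G v) λ v-not-entrance →
    let T , pdT , ∣T∣≤∣S∣ , fewer = Exchange.exchange three conn minS v∈S v-not-entrance
    in <⇒≱ fewer (fewest T (pdT , ≤-trans ∣T∣≤∣S∣ ∣S∣≤∣S₀∣))

-- One minimal fort per vertex; vertices outside S get an arbitrary one.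
minimal-forts-covering : ∀ {n} (G : Graph n) {S : Subset n} → (∀ v → v ∈ S → EntranceVertex G v) →
  Σ ℕ λ k → Σ (Fin k → Subset n) λ Fs →
    (∀ i → MinimalFort G (Fs i)) × (∀ v → v ∈ S → ∃ λ i → InEntrance G (Fs i) v)
minimal-forts-covering {n} G {S} all-enter =
  n , (λ v → proj₁ (choice v)) , (λ v → proj₁ (proj₂ (choice v))) , λ v v∈S → v , proj₂ (proj₂ (choice v)) v∈S
  where
  choice : ∀ v → ∃ λ F → MinimalFort G F × (v ∈ S → InEntrance G F v)
  choice v with v ∈? S
  ... | yes v∈S = let F , minF , enters = all-enter v v∈S in F , minF , λ _ → enters
  ... | no v∉S = let F , minF , _ = fort⇒minimalFort⊆ G (⊤-fort G v) in F , minF , λ v∈S → contradiction v∈S v∉S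

theorem3p11 : ∀ (n : ℕ) (G : Graph n) → 3 ≤ n → Connected G →
    Σ (Subset n) λ S → MinimumPowerDominating G S ×
      (Σ ℕ λ k → Σ (Fin k → Subset n) λ Fs →
        (∀ (i : Fin k) → MinimalFort G (Fs i)) ×
        (∀ (v : Fin n) → v ∈ S → ∃ λ (i : Fin k) → InEntrance G (Fs i) v))
theorem3p11 n G three conn =
  let S , minS , all-enter = minimum-pd-of-entrance-vertices G three conn
  in S , minS , minimal-forts-covering G all-enter
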